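{- Fix a nonnegative integer $k$ and a nonnegative integer $n$. Let $\mathcal{B}_n^{(k)}$ be the set of integer sequences $(v_1,\ldots,v_n)$ satisfying $1\le v_i\le i+k$ for all $i$, and such that for all $1\le i<j\le n$, $v_j-(j-i)\notin[1,v_i-1]$. Then $|\mathcal{B}_n^{(k)}|=C_n^{(k)}$, where $C_n^{(k)}=\frac{k+1}{2n+k+1}\binom{2n+k+1}{n}$.
   Context: $[a,b]$ denotes the set of integers $m$ with $a\le m\le b$ (empty if $b<a$). For $n=0$ the only sequence is the empty one. -}

module Defs where

open import Data.Nat as ℕ using (ℕ; suc; _+_; _*_; _/_)
open import Data.Nat.Combinatorics using (_C_)
open import Data.Fin using (Fin; toℕ; _<_)
open import Data.Integer as ℤ using (ℤ; +_; _-_)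
open import Data.Product using (_×_; Σ)
open import Data.Vec using (Vec; lookup)
open import Relation.Nullary using (¬_)

_∈[_,_] : ℤ → ℤ → ℤ → Set
m ∈[ a , b ] = (a ℤ.≤ m) × (m ℤ.≤ b)

pos : {n : ℕ} → Fin n → ℤ
pos i = + suc (toℕ i)

-- A sequence (v_1,…,v_n) is represented as v : Fin n → ℤ with v i = v_{toℕ i + 1}.
-- Membership in B_n^(k).
IsB : (k n : ℕ) → (Fin n → ℤ) → Set
IsB k n v =
  ((i : Fin n) → (v i) ∈[ + 1 , pos i ℤ.+ + k ])
  × ((i j : Fin n) → i < j →
       ¬ ((v j - (pos j - pos i)) ∈[ + 1 , v i - + 1 ]))

IsBVec : (k n : ℕ) → Vec ℤ n → Set
IsBVec k n v = IsB k n (lookup v)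

Cnum : (k n : ℕ) → ℕ
Cnum k n = ((k + 1) * ((2 * n + k + 1) C n)) / suc (2 * n + k)

module Submission where

-- Write w_j = v_j - j for the offset of the j-th entry. The condition for i < j says that
-- w_j avoids [1 - i, w_i - 1], and since 1 - j < 1 - i, choosing the entries from left to
-- right the offsets available for entry j + 1 are -j together with the offsets available
-- for entry j that are at least w_j; the first entry has the offsets [0, k] available.
-- So the number of sequences depends only on the sizes of these sets of available offsets,
-- and it obeys a ballot recurrence whose solution is C_n^(k).

open import Defs
open import Data.Nat using (ℕ; zero; suc; _+_; _*_; _∸_; _/_; _≤_; _<_; z≤n; s≤s)
open import Data.Nat.Properties
  using ( +-assoc; +-comm; +-identityʳ; +-suc; +-cancelʳ-≡; +-commutativeSemigroup
        ; *-comm; *-identityˡ; *-identityʳ; *-zeroʳ; *-distribˡ-+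
        ; ≤-refl; ≤-pred; <⇒≤; <-irrefl; <-≤-trans; m≤m+n; m≤n⇒m≤1+n; m+n∸n≡m
        ; suc-injective; 0≢1+n; _≤?_; ≰⇒> )
open import Data.Nat.Combinatorics using (_C_; nCk+nC[k+1]≡[n+1]C[k+1]; nCk≡nC[n∸k]; nC1≡n)
open import Data.Nat.DivMod using (m*n/n≡m)
open import Data.Nat.Tactic.RingSolver using (solve-∀)
open import Algebra.Properties.CommutativeSemigroup +-commutativeSemigroup using (interchange)
open import Data.Integer as ℤ using (ℤ; +_; -[1+_]; +≤+; _-_)
import Data.Integer.Properties as ℤₚ
open import Algebra.Properties.AbelianGroup ℤₚ.+-0-abelianGroup using (xyx⁻¹≈y)
open import Data.Fin as Fin using (Fin; toℕ)
open import Data.Vec using (Vec; []; _∷_; lookup)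
open import Data.List using (List; []; _∷_; map; _++_; length; upTo)
open import Data.List.Properties using (length-++; length-map; length-upTo)
open import Data.List.Membership.Propositional using (_∈_)
open import Data.List.Membership.Propositional.Properties
  using (∈-map⁺; ∈-map⁻; ∈-++⁺ˡ; ∈-++⁺ʳ; ∈-++⁻; ∈-upTo⁺)
open import Data.List.Relation.Unary.Any using (here; there)
open import Data.List.Relation.Unary.All as All using (All; []; _∷_)
import Data.List.Relation.Unary.All.Properties as All
open import Data.List.Relation.Unary.AllPairs as AllPairs using (AllPairs; []; _∷_)
import Data.List.Relation.Unary.AllPairs.Properties as AllPairs
open import Data.List.Relation.Unary.Unique.Propositional using (Unique)
import Data.List.Relation.Unary.Unique.Propositional.Properties as Unique
open import Data.Product using (Σ; _×_; _,_; proj₁; proj₂)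
open import Data.Sum using (inj₁; inj₂)
open import Data.Empty using (⊥-elim)
open import Function using (id)
open import Function.Bundles using (_⇔_; mk⇔)
open import Relation.Nullary using (¬_; yes; no)
open import Relation.Binary.PropositionalEquality
open ≡-Reasoning

-- count n s counts the sequences of length n when s offsets are available: choosing the
-- one with j available offsets above it leaves j + 2 available for the rest.
count : ℕ → ℕ → ℕ
count zero    s       = 1
count (suc n) zero    = 0
count (suc n) (suc s) = count n (suc (suc s)) + count (suc n) s

[k+1]*[n+1]C[k+1]≡[n+1]*nCk : ∀ n k → suc k * (suc n C suc k) ≡ suc n * (n C k)
[k+1]*[n+1]C[k+1]≡[n+1]*nCk zero    zero    = refl
[k+1]*[n+1]C[k+1]≡[n+1]*nCk zero    (suc k) = *-zeroʳ (suc (suc k))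
[k+1]*[n+1]C[k+1]≡[n+1]*nCk (suc n) zero    =
  trans (*-identityˡ ((2 + n) C 1)) (trans (nC1≡n (2 + n)) (sym (*-identityʳ (2 + n))))
[k+1]*[n+1]C[k+1]≡[n+1]*nCk (suc n) (suc k) = begin
    (2 + k) * ((2 + n) C (2 + k))
  ≡⟨ cong ((2 + k) *_) (sym (nCk+nC[k+1]≡[n+1]C[k+1] (suc n) (suc k))) ⟩
    (2 + k) * (X + Y)
  ≡⟨ split k X Y ⟩
    X + (suc k * X + (2 + k) * Y)
  ≡⟨ cong₂ (λ p q → X + (p + q)) ([k+1]*[n+1]C[k+1]≡[n+1]*nCk n k)
                                 ([k+1]*[n+1]C[k+1]≡[n+1]*nCk n (suc k)) ⟩
    X + (suc n * (n C k) + suc n * (n C suc k))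
  ≡⟨ cong (λ t → X + t) (sym (*-distribˡ-+ (suc n) (n C k) (n C suc k))) ⟩
    X + suc n * (n C k + n C suc k)
  ≡⟨ cong (λ t → X + suc n * t) (nCk+nC[k+1]≡[n+1]C[k+1] n k) ⟩
    X + suc n * X
  ∎
  where
    X Y : ℕ
    X = suc n C suc k
    Y = suc n C suc (suc k)
    split : ∀ k X Y → (2 + k) * (X + Y) ≡ X + (suc k * X + (2 + k) * Y)
    split = solve-∀

count-ballot : ∀ m s → count (suc m) s + suc (s + (m + m)) C m ≡ suc (s + (m + m)) C suc m
count-ballot m zero = begin
    suc (m + m) C m
  ≡⟨ nCk≡nC[n∸k] (m≤n⇒m≤1+n (m≤m+n m m)) ⟩
    suc (m + m) C (suc m + m ∸ m)
  ≡⟨ cong (suc (m + m) C_) (m+n∸n≡m (suc m) m) ⟩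
    suc (m + m) C suc m
  ∎
count-ballot zero (suc s) =
  trans (cong suc (count-ballot zero s)) (nCk+nC[k+1]≡[n+1]C[k+1] (suc (s + 0)) 0)
count-ballot (suc m) (suc s) = begin
    (a + b) + suc P C suc m
  ≡⟨ cong (λ t → (a + b) + t) (sym (nCk+nC[k+1]≡[n+1]C[k+1] P m)) ⟩
    (a + b) + (P C m + P C suc m)
  ≡⟨ interchange a b (P C m) (P C suc m) ⟩
    (a + P C m) + (b + P C suc m)
  ≡⟨ cong₂ _+_ a+PCm≡PC[1+m] (count-ballot (suc m) s) ⟩
    P C suc m + P C suc (suc m)
  ≡⟨ nCk+nC[k+1]≡[n+1]C[k+1] P (suc m) ⟩
    suc P C suc (suc m)
  ∎
  where
    P a b : ℕ
    P = suc (s + (suc m + suc m))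
    a = count (suc m) (suc (suc s))
    b = count (suc (suc m)) s
    shift : ∀ s m → suc (suc s) + (m + m) ≡ s + (suc m + suc m)
    shift = solve-∀
    a+PCm≡PC[1+m] : a + P C m ≡ P C suc m
    a+PCm≡PC[1+m] =
      subst (λ N → a + N C m ≡ N C suc m) (cong suc (shift s m)) (count-ballot m (suc (suc s)))

-- With F = count n (k + 1), M = 2n + k + 1, X = (M - 1) C (n - 1), Y = (M - 1) C n and
-- Z = M C n: the ballot identity gives F = Y - X, absorption gives n Z = M X, and
-- Pascal's rule Z = X + Y, hence M F = M Y - n Z = M Z - 2 n Z = (k + 1) Z.
count-closed : ∀ n k → suc (n + n + k) * count n (suc k) ≡ suc k * (suc (n + n + k) C n)
count-closed zero    k = trans (*-identityʳ (suc k)) (sym (*-identityʳ (suc k)))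
count-closed (suc m) k = +-cancelʳ-≡ (n * Z + n * Z) (M * F) (suc k * Z) (begin
    M * F + (n * Z + n * Z)
  ≡⟨ cong (λ t → M * F + (t + n * Z)) nZ≡MX ⟩
    M * F + (M * X + n * Z)
  ≡⟨ sym (+-assoc (M * F) (M * X) (n * Z)) ⟩
    M * F + M * X + n * Z
  ≡⟨ cong (_+ n * Z) (sym (*-distribˡ-+ M F X)) ⟩
    M * (F + X) + n * Z
  ≡⟨ cong (λ t → M * t + n * Z) F+X≡Y ⟩
    M * Y + n * Z
  ≡⟨ cong (λ t → M * Y + t) nZ≡MX ⟩
    M * Y + M * X
  ≡⟨ sym (*-distribˡ-+ M Y X) ⟩
    M * (Y + X)
  ≡⟨ cong (M *_) (trans (+-comm Y X) (nCk+nC[k+1]≡[n+1]C[k+1] (n + n + k) m)) ⟩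
    M * Z
  ≡⟨ unfold-M n k Z ⟩
    suc k * Z + (n * Z + n * Z)
  ∎)
  where
    n M F X Y Z : ℕ
    n = suc m
    M = suc (n + n + k)
    F = count n (suc k)
    X = (n + n + k) C m
    Y = (n + n + k) C n
    Z = M C n
    nZ≡MX : n * Z ≡ M * X
    nZ≡MX = [k+1]*[n+1]C[k+1]≡[n+1]*nCk (n + n + k) m
    shift : ∀ m k → suc (suc k + (m + m)) ≡ suc m + suc m + k
    shift = solve-∀
    F+X≡Y : F + X ≡ Y
    F+X≡Y = subst (λ N → F + N C m ≡ N C n) (shift m k) (count-ballot m (suc k))
    unfold-M : ∀ n k Z → suc (n + n + k) * Z ≡ suc k * Z + (n * Z + n * Z)
    unfold-M = solve-∀

count≡Cnum : ∀ k n → count n (suc k) ≡ Cnum k n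
count≡Cnum k n = sym (begin
    ((k + 1) * ((2 * n + k + 1) C n)) / suc (2 * n + k)
  ≡⟨ cong (λ t → ((k + 1) * ((t + 1) C n)) / suc t) (cong (λ t → n + t + k) (+-identityʳ n)) ⟩
    ((k + 1) * ((n + n + k + 1) C n)) / suc (n + n + k)
  ≡⟨ cong₂ (λ p q → (p * (q C n)) / suc (n + n + k)) (+-comm k 1) (+-comm (n + n + k) 1) ⟩
    (suc k * (suc (n + n + k) C n)) / suc (n + n + k)
  ≡⟨ cong (_/ suc (n + n + k)) (sym (count-closed n k)) ⟩
    (suc (n + n + k) * count n (suc k)) / suc (n + n + k)
  ≡⟨ cong (_/ suc (n + n + k)) (*-comm (suc (n + n + k)) (count n (suc k))) ⟩
    (count n (suc k) * suc (n + n + k)) / suc (n + n + k)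
  ≡⟨ m*n/n≡m (count n (suc k)) (suc (n + n + k)) ⟩
    count n (suc k)
  ∎)

private
  variable
    a b m n : ℕ
    r A B : List ℕ
    x : ℤ
    v : Vec ℤ n

data Suffix : List ℕ → List ℕ → Set where
  self : Suffix A A
  skip : Suffix A B → Suffix A (b ∷ B)

suffix-∈ : Suffix (a ∷ r) A → a ∈ A
suffix-∈ self     = here refl
suffix-∈ (skip s) = there (suffix-∈ s)

suffix-⊆ : Suffix B A → m ∈ B → m ∈ A
suffix-⊆ self     m∈B = m∈B
suffix-⊆ (skip s) m∈B = there (suffix-⊆ s m∈B)

∈⇒suffix : a ∈ A → Σ (List ℕ) λ r → Suffix (a ∷ r) A
∈⇒suffix (here refl) = _ , self
∈⇒suffix (there a∈A) with r , s ← ∈⇒suffix a∈A = r , skip s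

All-suffix : ∀ {P : ℕ → Set} → Suffix B A → All P A → All P B
All-suffix self     ps       = ps
All-suffix (skip s) (_ ∷ ps) = All-suffix s ps

AllPairs-suffix : ∀ {R : ℕ → ℕ → Set} → Suffix B A → AllPairs R A → AllPairs R B
AllPairs-suffix self     ps       = ps
AllPairs-suffix (skip s) (_ ∷ ps) = AllPairs-suffix s ps

head-≤ : AllPairs _<_ (a ∷ r) → m ∈ a ∷ r → a ≤ m
head-≤ _         (here refl) = ≤-refl
head-≤ (a<r ∷ _) (there m∈r) = <⇒≤ (All.lookup a<r m∈r)

∈-suffix : AllPairs _<_ A → Suffix (a ∷ r) A → m ∈ A → a ≤ m → m ∈ a ∷ r
∈-suffix _            self     m∈A         _   = m∈A
∈-suffix (b<B ∷ _)    (skip s) (here refl) a≤m =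
  ⊥-elim (<-irrefl refl (<-≤-trans (All.lookup b<B (suffix-∈ s)) a≤m))
∈-suffix (_ ∷ sorted) (skip s) (there m∈B) a≤m = ∈-suffix sorted s m∈B a≤m

-- The offsets available at the next position, measured from that position: choosing a
-- from the suffix a ∷ r of the available list forbids the available values below a, and
-- moving one position to the right shifts everything by one and frees the new value 0.
next : ℕ → List ℕ → List ℕ
next a r = 0 ∷ map suc (a ∷ r)

next-unique : Unique (a ∷ r) → Unique (next a r)
next-unique {a} {r} u =
  All.map⁺ (All.universal (λ _ → 0≢1+n) (a ∷ r)) ∷ Unique.map⁺ suc-injective u

next-sorted : AllPairs _<_ (a ∷ r) → AllPairs _<_ (next a r)
next-sorted {a} {r} sorted =
  All.map⁺ (All.universal (λ _ → s≤s z≤n) (a ∷ r)) ∷ AllPairs.map⁺ (AllPairs.map s≤s sorted)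

next-bounded : ∀ {K} → All (_≤ K) (a ∷ r) → All (_≤ suc K) (next a r)
next-bounded bounded = z≤n ∷ All.map⁺ (All.map s≤s bounded)

enum : (n : ℕ) → List ℕ → List (Vec ℤ n)
enum∷ : (n : ℕ) → List ℕ → List (Vec ℤ (suc n))
enum zero    A = [] ∷ []
enum (suc n) A = enum∷ n A
enum∷ n []      = []
enum∷ n (a ∷ r) = map (+ suc a ∷_) (enum n (next a r)) ++ enum∷ n r

length-enum : ∀ n A → length (enum n A) ≡ count n (length A)
length-enum∷ : ∀ n A → length (enum∷ n A) ≡ count (suc n) (length A)
length-enum zero    A = refl
length-enum (suc n) A = length-enum∷ n A
length-enum∷ n []      = refl
length-enum∷ n (a ∷ r) = begin
    length (map (+ suc a ∷_) (enum n (next a r)) ++ enum∷ n r)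
  ≡⟨ length-++ (map (+ suc a ∷_) (enum n (next a r))) ⟩
    length (map (+ suc a ∷_) (enum n (next a r))) + length (enum∷ n r)
  ≡⟨ cong₂ _+_ (length-map (+ suc a ∷_) (enum n (next a r))) (length-enum∷ n r) ⟩
    length (enum n (next a r)) + count (suc n) (length r)
  ≡⟨ cong (_+ count (suc n) (length r)) (length-enum n (next a r)) ⟩
    count n (suc (suc (length (map suc r)))) + count (suc n) (length r)
  ≡⟨ cong (λ l → count n (suc (suc l)) + count (suc n) (length r)) (length-map suc r) ⟩
    count n (suc (suc (length r))) + count (suc n) (length r)
  ∎

data Admissible : List ℕ → Vec ℤ n → Set where
  []  : Admissible A []
  _∷_ : Suffix (a ∷ r) A → Admissible (next a r) v → Admissible A (+ suc a ∷ v)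

Admissible-head : Admissible A (x ∷ v) → Σ ℕ λ b → b ∈ A × x ≡ + suc b
Admissible-head (s ∷ _) = _ , suffix-∈ s , refl

∈-enum⁻ : ∀ n A {v : Vec ℤ n} → v ∈ enum n A → Admissible A v
∈-enum∷⁻ : ∀ n A {v : Vec ℤ (suc n)} → v ∈ enum∷ n A → Admissible A v
∈-enum⁻ zero    A {[]} _  = []
∈-enum⁻ (suc n) A      v∈ = ∈-enum∷⁻ n A v∈
∈-enum∷⁻ n (a ∷ r) v∈ with ∈-++⁻ (map (+ suc a ∷_) (enum n (next a r))) v∈
... | inj₁ v∈map with w , w∈ , refl ← ∈-map⁻ (+ suc a ∷_) v∈map = self ∷ ∈-enum⁻ n (next a r) w∈
... | inj₂ v∈rest with s ∷ adm ← ∈-enum∷⁻ n r v∈rest = skip s ∷ adm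

∈-enum⁺ : Admissible A v → v ∈ enum n A
∈-enum∷⁺ : {v : Vec ℤ (suc n)} → Admissible A v → v ∈ enum∷ n A
∈-enum⁺ {n = zero}  []  = here refl
∈-enum⁺ {n = suc n} adm = ∈-enum∷⁺ adm
∈-enum∷⁺ (self ∷ adm) = ∈-++⁺ˡ (∈-map⁺ _ (∈-enum⁺ adm))
∈-enum∷⁺ {A = b ∷ B} (skip s ∷ adm) =
  ∈-++⁺ʳ (map (+ suc b ∷_) (enum _ (next b B))) (∈-enum∷⁺ (s ∷ adm))

enum-unique : ∀ n → Unique A → Unique (enum n A)
enum∷-unique : ∀ n → Unique A → Unique (enum∷ n A)
enum-unique zero    _ = [] ∷ []
enum-unique (suc n) u = enum∷-unique n u
enum∷-unique {[]}    n _ = []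
enum∷-unique {a ∷ r} n u@(a∉r ∷ ur) =
  Unique.++⁺ (Unique.map⁺ ∷-injectiveʳ (enum-unique n (next-unique u))) (enum∷-unique n ur) disjoint
  where
    ∷-injectiveʳ : {w w′ : Vec ℤ n} → (+ suc a ∷ w) ≡ (+ suc a ∷ w′) → w ≡ w′
    ∷-injectiveʳ refl = refl
    disjoint : ∀ {v} → ¬ (v ∈ map (+ suc a ∷_) (enum n (next a r)) × v ∈ enum∷ n r)
    disjoint (v∈map , v∈rest) with _ , _ , refl ← ∈-map⁻ (+ suc a ∷_) v∈map
                               with b , b∈r , eq ← Admissible-head (∈-enum∷⁻ n r v∈rest)
      = All.lookup a∉r b∈r (suc-injective (ℤₚ.+-injective eq))

offset : Vec ℤ n → Fin n → ℤ
offset v j = lookup v j - pos j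

-- Negative offsets are never forbidden.
Allowed : List ℕ → ℤ → Set
Allowed A w = ∀ {z} → w ≡ + z → z ∈ A

pos-suc-bound : ∀ (i : Fin n) K → pos (Fin.suc i) ℤ.+ + K ≡ pos i ℤ.+ + suc K
pos-suc-bound i K = cong (λ t → + suc t) (sym (+-suc (toℕ i) K))

pos-suc-diff : ∀ (i j : Fin n) → pos (Fin.suc j) - pos (Fin.suc i) ≡ pos j - pos i
pos-suc-diff i j = ℤₚ.[1+m]⊖[1+n]≡m⊖n (suc (toℕ j)) (suc (toℕ i))

offset-suc : ∀ x (v : Vec ℤ n) j → offset (x ∷ v) (Fin.suc j) ≡ offset v j - + 1
offset-suc x v j = sym (trans (ℤₚ.+-assoc (lookup v j) -[1+ toℕ j ] -[1+ 0 ])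
                              (cong (λ t → lookup v j ℤ.+ -[1+ suc t ]) (+-identityʳ (toℕ j))))

IsBVec-∷⁻ : ∀ K x (v : Vec ℤ n) → IsBVec K (suc n) (x ∷ v) →
  x ∈[ + 1 , + suc K ] × IsBVec (suc K) n v × (∀ j → ¬ offset v j ∈[ + 1 , x - + 1 ])
IsBVec-∷⁻ K x v (bounded , avoids) =
  bounded Fin.zero , (bounded′ , avoids′) , λ j → avoids Fin.zero (Fin.suc j) (s≤s z≤n)
  where
    bounded′ : ∀ i → lookup v i ∈[ + 1 , pos i ℤ.+ + suc K ]
    bounded′ i = subst (lookup v i ∈[ + 1 ,_]) (pos-suc-bound i K) (bounded (Fin.suc i))
    avoids′ : ∀ i j → i Fin.< j → ¬ (lookup v j - (pos j - pos i)) ∈[ + 1 , lookup v i - + 1 ]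
    avoids′ i j i<j = subst (λ d → ¬ (lookup v j - d) ∈[ + 1 , lookup v i - + 1 ]) (pos-suc-diff i j)
                            (avoids (Fin.suc i) (Fin.suc j) (s≤s i<j))

IsBVec-∷⁺ : ∀ K x (v : Vec ℤ n) → x ∈[ + 1 , + suc K ] → IsBVec (suc K) n v →
  (∀ j → ¬ offset v j ∈[ + 1 , x - + 1 ]) → IsBVec K (suc n) (x ∷ v)
IsBVec-∷⁺ K x v x-bounded (bounded , avoids) x-avoided = bounded′ , avoids′
  where
    bounded′ : ∀ i → lookup (x ∷ v) i ∈[ + 1 , pos i ℤ.+ + K ]
    bounded′ Fin.zero    = x-bounded
    bounded′ (Fin.suc i) = subst (lookup v i ∈[ + 1 ,_]) (sym (pos-suc-bound i K)) (bounded i)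
    avoids′ : ∀ i j → i Fin.< j →
      ¬ (lookup (x ∷ v) j - (pos j - pos i)) ∈[ + 1 , lookup (x ∷ v) i - + 1 ]
    avoids′ Fin.zero    (Fin.suc j) _         = x-avoided j
    avoids′ (Fin.suc i) (Fin.suc j) (s≤s i<j) =
      subst (λ d → ¬ (lookup v j - d) ∈[ + 1 , lookup v i - + 1 ]) (sym (pos-suc-diff i j)) (avoids i j i<j)

Allowed-next⁻ : AllPairs _<_ A → Suffix (a ∷ r) A → ∀ w →
  Allowed (next a r) w → ¬ w ∈[ + 1 , + a ] × Allowed A (w - + 1)
Allowed-next⁻ sorted s -[1+ m ]  _       = (λ { (() , _) }) , λ ()
Allowed-next⁻ sorted s (+ zero)  _       = (λ { (+≤+ () , _) }) , λ ()
Allowed-next⁻ sorted s (+ suc m) allowed with allowed refl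
... | there m+1∈ with y , y∈ , refl ← ∈-map⁻ suc m+1∈ =
  (λ { (_ , +≤+ m<a) → <-irrefl refl (<-≤-trans m<a (head-≤ (AllPairs-suffix s sorted) y∈)) }) ,
  λ { refl → suffix-⊆ s y∈ }

Allowed-next⁺ : AllPairs _<_ A → Suffix (a ∷ r) A → ∀ w →
  ¬ w ∈[ + 1 , + a ] → Allowed A (w - + 1) → Allowed (next a r) w
Allowed-next⁺ sorted s (+ zero)  _       _       refl = here refl
Allowed-next⁺ {a = a} sorted s (+ suc m) outside allowed refl with a ≤? m
... | yes a≤m = there (∈-map⁺ suc (∈-suffix sorted s (allowed refl) a≤m))
... | no  a≰m = ⊥-elim (outside (+≤+ (s≤s z≤n) , +≤+ (≰⇒> a≰m)))

Admissible⇒IsBVec : ∀ K → AllPairs _<_ A → All (_≤ K) A → Admissible A v →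
  IsBVec K n v × (∀ j → Allowed A (offset v j))
Admissible⇒IsBVec K _ _ [] = ((λ ()) , (λ ())) , λ ()
Admissible⇒IsBVec {A = A} K sorted bounded (_∷_ {a = a} {v = v} s adm)
  with isB , allowed ← Admissible⇒IsBVec (suc K) (next-sorted (AllPairs-suffix s sorted))
                                                (next-bounded (All-suffix s bounded)) adm
  = IsBVec-∷⁺ K (+ suc a) v (+≤+ (s≤s z≤n) , +≤+ (s≤s (All.lookup bounded (suffix-∈ s))))
              isB (λ j → proj₁ (Allowed-next⁻ sorted s (offset v j) (allowed j))) ,
    λ { Fin.zero refl → suffix-∈ s
      ; (Fin.suc j) → subst (Allowed A) (sym (offset-suc (+ suc a) v j))
                            (proj₂ (Allowed-next⁻ sorted s (offset v j) (allowed j))) }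

IsBVec⇒Admissible : ∀ K → AllPairs _<_ A → All (_≤ K) A → (v : Vec ℤ n) →
  IsBVec K n v → (∀ j → Allowed A (offset v j)) → Admissible A v
IsBVec⇒Admissible K _ _ [] _ _ = []
IsBVec⇒Admissible {A = A} K sorted bounded (x ∷ v) isB allowed
  with (+≤+ (s≤s _) , _) , isB′ , avoids ← IsBVec-∷⁻ K x v isB
  with r , s ← ∈⇒suffix (allowed Fin.zero refl)
  = s ∷ IsBVec⇒Admissible (suc K) (next-sorted (AllPairs-suffix s sorted))
                          (next-bounded (All-suffix s bounded)) v isB′
          (λ j → Allowed-next⁺ sorted s (offset v j) (avoids j)
                               (subst (Allowed A) (offset-suc x v j) (allowed (Fin.suc j))))

i≤j+k⇒i-j≤k : ∀ {i j k} → i ℤ.≤ j ℤ.+ k → i - j ℤ.≤ k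
i≤j+k⇒i-j≤k {i} {j} {k} i≤j+k =
  ℤₚ.≤-trans (ℤₚ.+-monoˡ-≤ (ℤ.- j) i≤j+k) (ℤₚ.≤-reflexive (xyx⁻¹≈y j k))

IsBVec⇒Allowed-upTo : ∀ k (v : Vec ℤ n) → IsBVec k n v → ∀ j → Allowed (upTo (suc k)) (offset v j)
IsBVec⇒Allowed-upTo k v (bounded , _) j offset≡z =
  ∈-upTo⁺ (s≤s (ℤₚ.drop‿+≤+ (subst (ℤ._≤ + k) offset≡z (i≤j+k⇒i-j≤k (proj₂ (bounded j))))))

proposition2 : (k n : ℕ) →
    Σ (List (Vec ℤ n)) λ L →
      Unique L × ((v : Vec ℤ n) → (v ∈ L) ⇔ IsBVec k n v) × (length L ≡ Cnum k n)
proposition2 k n = enum n A₀ , enum-unique n (Unique.upTo⁺ (suc k)) , characterisation , size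
  where
    A₀ : List ℕ
    A₀ = upTo (suc k)
    sorted : AllPairs _<_ A₀
    sorted = AllPairs.applyUpTo⁺₁ id (suc k) (λ i<j _ → i<j)
    bounded : All (_≤ k) A₀
    bounded = All.map ≤-pred (All.all-upTo (suc k))
    characterisation : (v : Vec ℤ n) → (v ∈ enum n A₀) ⇔ IsBVec k n v
    characterisation v = mk⇔
      (λ v∈ → proj₁ (Admissible⇒IsBVec k sorted bounded (∈-enum⁻ n A₀ v∈)))
      (λ isB → ∈-enum⁺ (IsBVec⇒Admissible k sorted bounded v isB (IsBVec⇒Allowed-upTo k v isB)))
    size : length (enum n A₀) ≡ Cnum k n
    size = trans (length-enum n A₀) (trans (cong (count n) (length-upTo (suc k))) (count≡Cnum k n))
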